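{- For all integers $v\ge4$ and $d\ge1$, $\left|\mathcal{D}_{v,d}(231)\right| = \left|\mathcal{D}_{v,d}(312)\right|$.
   Context: A diamond with $v$ vertices ($v\ge4$) is the poset with a least element, a greatest element, and $v-2$ pairwise incomparable middle elements (in a fixed left-to-right order) strictly between them. $\mathcal{D}_{v,d}$ is the set of labellings of $d$ diamonds (placed left to right) by $1,\dots,vd$, each label used once, such that in each diamond least label $<$ each middle label $<$ greatest label. For $D\in\mathcal{D}_{v,d}$, $\pi_D$ is the permutation obtained by reading the diamonds left to right and, within each diamond, the least element, then the middle elements left to right, then the greatest element. $\mathcal{D}_{v,d}(p)$ is the set of $D$ with $\pi_D$ avoiding the classical pattern $p$. -}

module Defs where

open import Data.Nat as ℕ using (ℕ; zero; suc; _∸_)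
open import Data.Fin as Fin using (Fin; toℕ; remQuot)
open import Data.Fin.Base using (_<_)
open import Data.Product using (Σ; _×_; _,_; proj₁; proj₂; ∃)
open import Function.Definitions using (Injective)
open import Relation.Binary.PropositionalEquality using (_≡_)
open import Relation.Nullary using (¬_)

-- A labelling of d diamonds with v vertices each.  Diamond i (0-based,
-- left to right), vertex j (0-based) where vertex 0 is the least element,
-- vertices 1 .. v-2 are the middle elements (left to right) and vertex v-1
-- is the greatest element.  Labels are Fin (d * v), i.e. 0 .. dv-1, an
-- order-preserving shift of 1 .. vd.
Labelling : ℕ → ℕ → Set
Labelling v d = Fin d → Fin v → Fin (d ℕ.* v)

-- The reading permutation π_D : position (i * v + j) ↦ label of vertex j of
-- diamond i (least, middles left to right, greatest).
πD : ∀ {v d} → Labelling v d → Fin (d ℕ.* v) → Fin (d ℕ.* v)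
πD {v} {d} D k = D (proj₁ (remQuot {d} v k)) (proj₂ (remQuot {d} v k))

record IsDiamondLabelling {v d : ℕ} (D : Labelling v d) : Set where
  field
    labels-once : Injective _≡_ _≡_ (πD D)
    least<middle : ∀ (i : Fin d) (j k : Fin v) →
      toℕ j ≡ 0 → 0 ℕ.< toℕ k → toℕ k ℕ.< v ∸ 1 → D i j < D i k
    middle<greatest : ∀ (i : Fin d) (j k : Fin v) →
      0 ℕ.< toℕ j → toℕ j ℕ.< v ∸ 1 → toℕ k ≡ v ∸ 1 → D i j < D i k

Contains : ∀ {m n} → (Fin m → Fin m) → (Fin n → Fin n) → Set
Contains {m} {n} p π =
  Σ (Fin m → Fin n) λ f →
    (∀ a b → a < b → f a < f b) ×
    (∀ a b → (p a < p b → π (f a) < π (f b)) × (π (f a) < π (f b) → p a < p b))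

Avoids : ∀ {m n} → (Fin m → Fin m) → (Fin n → Fin n) → Set
Avoids p π = ¬ Contains p π

-- Patterns in one-line notation, with values shifted to 0-based.
p231 : Fin 3 → Fin 3
p231 Fin.zero = Fin.suc Fin.zero
p231 (Fin.suc Fin.zero) = Fin.suc (Fin.suc Fin.zero)
p231 (Fin.suc (Fin.suc Fin.zero)) = Fin.zero

p312 : Fin 3 → Fin 3
p312 Fin.zero = Fin.suc (Fin.suc Fin.zero)
p312 (Fin.suc Fin.zero) = Fin.zero
p312 (Fin.suc (Fin.suc Fin.zero)) = Fin.suc Fin.zero

𝒟 : (v d : ℕ) → ∀ {m} → (Fin m → Fin m) → Set
𝒟 v d p = Σ (Labelling v d) λ D → IsDiamondLabelling D × Avoids p (πD D)

-- Two labellings are the same element of 𝒟_{v,d} iff they assign the same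
-- label to every vertex (membership proofs are irrelevant).
_≈L_ : ∀ {v d} → Labelling v d → Labelling v d → Set
D ≈L E = ∀ i j → D i j ≡ E i j

SameCard : ∀ {v d} (P Q : Labelling v d → Set) → Set
SameCard {v} {d} P Q =
  Σ (Σ (Labelling v d) P → Σ (Labelling v d) Q) λ f →
  Σ (Σ (Labelling v d) Q → Σ (Labelling v d) P) λ g →
    (∀ x → proj₁ (g (f x)) ≈L proj₁ x) × (∀ y → proj₁ (f (g y)) ≈L proj₁ y)

SameSize𝒟 : (v d : ℕ) → ∀ {m} → (p q : Fin m → Fin m) → Set
SameSize𝒟 v d p q =
  SameCard {v} {d} (λ D → IsDiamondLabelling D × Avoids p (πD D))
                   (λ D → IsDiamondLabelling D × Avoids q (πD D))

-- Reverse-complement (rotating the picture of a permutation by 180°) maps 231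
-- to 312.  On labellings it is D ↦ (i , j ↦ dv−1 − D (d−1−i) (v−1−j)): reading
-- diamonds and vertices backwards reverse-complements π_D, and since it swaps
-- least and greatest vertices while permuting the middle ones, it preserves
-- 𝒟_{v,d}.  Being an involution, it is a bijection 𝒟_{v,d}(231) ≅ 𝒟_{v,d}(312).
module Submission where

open import Defs
open import Data.Nat using (ℕ; _≤_)
open import Data.Nat as ℕ using (suc; _+_; _*_; _∸_)
open import Data.Nat.Properties
  using (m+n∸n≡m; m∸n+n≡m; n∸n≡0; m<n⇒0<n∸m; ∸-monoʳ-<; <⇒≤)
open import Data.Nat.Tactic.RingSolver using (solve-∀)
open import Data.Fin using (Fin; toℕ; opposite; combine; remQuot; _<_)
open import Data.Fin.Properties
  using (opposite-prop; opposite-involutive; toℕ-combine; remQuot-combine;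
         combine-remQuot; toℕ-injective; toℕ<n)
open import Data.Product using (_×_; _,_; proj₁; proj₂)
open import Function using (_∘_)
open import Function.Definitions using (Injective)
open import Relation.Binary.PropositionalEquality
  using (_≡_; _≗_; refl; sym; trans; cong; cong₂; subst₂; module ≡-Reasoning)

private
  variable
    m n v d : ℕ

opposite-unique : (i k : Fin n) → toℕ k + suc (toℕ i) ≡ n → opposite i ≡ k
opposite-unique {n} i k k+1+i≡n = toℕ-injective (begin
  toℕ (opposite i)                  ≡⟨ opposite-prop i ⟩
  n ∸ suc (toℕ i)                   ≡⟨ cong (_∸ suc (toℕ i)) (sym k+1+i≡n) ⟩
  toℕ k + suc (toℕ i) ∸ suc (toℕ i) ≡⟨ m+n∸n≡m (toℕ k) (suc (toℕ i)) ⟩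
  toℕ k                             ∎)
  where open ≡-Reasoning

toℕ-opposite+suc : (i : Fin n) → toℕ (opposite i) + suc (toℕ i) ≡ n
toℕ-opposite+suc i = trans (cong (_+ suc (toℕ i)) (opposite-prop i)) (m∸n+n≡m (toℕ<n i))

opposite-injective : Injective _≡_ _≡_ (opposite {n})
opposite-injective {x = i} {j} oi≡oj = begin
  i                       ≡⟨ opposite-involutive i ⟨
  opposite (opposite i)   ≡⟨ cong opposite oi≡oj ⟩
  opposite (opposite j)   ≡⟨ opposite-involutive j ⟩
  j                       ∎
  where open ≡-Reasoning

opposite-reverses-< : {i j : Fin n} → i < j → opposite j < opposite i
opposite-reverses-< {i = i} {j} i<j
  rewrite opposite-prop i | opposite-prop j = ∸-monoʳ-< (ℕ.s≤s i<j) (toℕ<n j)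

opposite-reflects-< : {i j : Fin n} → opposite i < opposite j → j < i
opposite-reflects-< {i = i} {j} oi<oj =
  subst₂ _<_ (opposite-involutive j) (opposite-involutive i) (opposite-reverses-< oi<oj)

mixedRadix-complement : ∀ {a b x y} → a + suc x ≡ d → b + suc y ≡ v →
                        v * a + b + suc (v * x + y) ≡ d * v
mixedRadix-complement {a = a} {b} {x} {y} refl refl = identity a b x y
  where
  identity : ∀ a b x y →
    (b + suc y) * a + b + suc ((b + suc y) * x + y) ≡ (a + suc x) * (b + suc y)
  identity = solve-∀

opposite-combine : (i : Fin d) (j : Fin v) →
                   opposite (combine i j) ≡ combine (opposite i) (opposite j)
opposite-combine {d} {v} i j = opposite-unique (combine i j) (combine (opposite i) (opposite j)) (begin
  toℕ (combine (opposite i) (opposite j)) + suc (toℕ (combine i j))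
    ≡⟨ cong₂ (λ a b → a + suc b) (toℕ-combine (opposite i) (opposite j)) (toℕ-combine i j) ⟩
  v * toℕ (opposite i) + toℕ (opposite j) + suc (v * toℕ i + toℕ j)
    ≡⟨ mixedRadix-complement (toℕ-opposite+suc i) (toℕ-opposite+suc j) ⟩
  d * v ∎)
  where open ≡-Reasoning

remQuot-opposite : ∀ v (k : Fin (d * v)) →
  remQuot {d} v (opposite k) ≡ (opposite (proj₁ (remQuot {d} v k)) , opposite (proj₂ (remQuot {d} v k)))
remQuot-opposite {d} v k = begin
  remQuot v (opposite k)                        ≡⟨ cong (remQuot v ∘ opposite) (combine-remQuot {d} v k) ⟨
  remQuot v (opposite (combine i j))            ≡⟨ cong (remQuot v) (opposite-combine i j) ⟩
  remQuot v (combine (opposite i) (opposite j)) ≡⟨ remQuot-combine (opposite i) (opposite j) ⟩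
  (opposite i , opposite j)                     ∎
  where
  open ≡-Reasoning
  i = proj₁ (remQuot {d} v k)
  j = proj₂ (remQuot {d} v k)

reverseComplement : (Fin n → Fin n) → Fin n → Fin n
reverseComplement π = opposite ∘ π ∘ opposite

reverseComplement-involutive : (π : Fin n → Fin n) → reverseComplement (reverseComplement π) ≗ π
reverseComplement-involutive π k
  rewrite opposite-involutive k = opposite-involutive (π k)

reverseComplement-injective : {π : Fin n → Fin n} →
                              Injective _≡_ _≡_ π → Injective _≡_ _≡_ (reverseComplement π)
reverseComplement-injective π-inj = opposite-injective ∘ π-inj ∘ opposite-injective

reverseComplement-p231 : reverseComplement p231 ≗ p312
reverseComplement-p231 Fin.zero = refl
reverseComplement-p231 (Fin.suc Fin.zero) = refl
reverseComplement-p231 (Fin.suc (Fin.suc Fin.zero)) = refl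

reverseComplement-p312 : reverseComplement p312 ≗ p231
reverseComplement-p312 Fin.zero = refl
reverseComplement-p312 (Fin.suc Fin.zero) = refl
reverseComplement-p312 (Fin.suc (Fin.suc Fin.zero)) = refl

Contains-resp-≗ : {p p′ : Fin m → Fin m} {π π′ : Fin n → Fin n} →
                  p ≗ p′ → π ≗ π′ → Contains p π → Contains p′ π′
Contains-resp-≗ p≗p′ π≗π′ (f , f-mono , f-order) = f , f-mono , λ a b →
    (λ pa<pb → subst₂ _<_ (π≗π′ (f a)) (π≗π′ (f b))
                 (proj₁ (f-order a b) (subst₂ _<_ (sym (p≗p′ a)) (sym (p≗p′ b)) pa<pb)))
  , (λ πa<πb → subst₂ _<_ (p≗p′ a) (p≗p′ b)
                 (proj₂ (f-order a b) (subst₂ _<_ (sym (π≗π′ (f a))) (sym (π≗π′ (f b))) πa<πb)))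

Contains-reverseComplement : {p : Fin m → Fin m} {π : Fin n → Fin n} →
  Contains p π → Contains (reverseComplement p) (reverseComplement π)
Contains-reverseComplement {p = p} {π} (f , f-mono , f-order) = g , g-mono , g-order
  where
  g : _ → _
  g = opposite ∘ f ∘ opposite

  g-mono : ∀ a b → a < b → g a < g b
  g-mono a b = opposite-reverses-< ∘ f-mono (opposite b) (opposite a) ∘ opposite-reverses-<

  π-g : ∀ a → reverseComplement π (g a) ≡ opposite (π (f (opposite a)))
  π-g a = cong (opposite ∘ π) (opposite-involutive (f (opposite a)))

  g-order : ∀ a b → (reverseComplement p a < reverseComplement p b →
                       reverseComplement π (g a) < reverseComplement π (g b))
                  × (reverseComplement π (g a) < reverseComplement π (g b) →
                       reverseComplement p a < reverseComplement p b)
  g-order a b =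
      (λ rpa<rpb → subst₂ _<_ (sym (π-g a)) (sym (π-g b)) (opposite-reverses-<
         (proj₁ (f-order (opposite b) (opposite a)) (opposite-reflects-< rpa<rpb))))
    , (λ rπa<rπb → opposite-reverses-< (proj₂ (f-order (opposite b) (opposite a))
         (opposite-reflects-< (subst₂ _<_ (π-g a) (π-g b) rπa<rπb))))

Avoids-reverseComplement : {p : Fin m → Fin m} {π : Fin n → Fin n} →
  Avoids p π → Avoids (reverseComplement p) (reverseComplement π)
Avoids-reverseComplement {p = p} {π} p-avoided =
  p-avoided ∘ Contains-resp-≗ (reverseComplement-involutive p) (reverseComplement-involutive π)
            ∘ Contains-reverseComplement {p = reverseComplement p} {reverseComplement π}

reverseComplementᴸ : Labelling v d → Labelling v d
reverseComplementᴸ D i j = opposite (D (opposite i) (opposite j))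

reverseComplementᴸ-involutive : (D : Labelling v d) → reverseComplementᴸ (reverseComplementᴸ D) ≈L D
reverseComplementᴸ-involutive D i j
  rewrite opposite-involutive i | opposite-involutive j = opposite-involutive (D i j)

πD-reverseComplementᴸ : (D : Labelling v d) → πD (reverseComplementᴸ D) ≗ reverseComplement (πD D)
πD-reverseComplementᴸ {v} {d} D k =
  cong (λ (i , j) → opposite (D i j)) (sym (remQuot-opposite {d} v k))

toℕ-opposite-least : (j : Fin v) → toℕ j ≡ 0 → toℕ (opposite j) ≡ v ∸ 1
toℕ-opposite-least {v} j j≡0 = trans (opposite-prop j) (cong (λ t → v ∸ suc t) j≡0)

toℕ-opposite-greatest : (j : Fin v) → toℕ j ≡ v ∸ 1 → toℕ (opposite j) ≡ 0
toℕ-opposite-greatest {suc w} j j≡w =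
  trans (opposite-prop j) (trans (cong (w ∸_) j≡w) (n∸n≡0 w))

toℕ-opposite-middle : (j : Fin v) → 0 ℕ.< toℕ j → toℕ j ℕ.< v ∸ 1 →
                      0 ℕ.< toℕ (opposite j) × toℕ (opposite j) ℕ.< v ∸ 1
toℕ-opposite-middle {suc w} j 0<j j<w rewrite opposite-prop j =
  m<n⇒0<n∸m j<w , ∸-monoʳ-< 0<j (<⇒≤ j<w)

IsDiamondLabelling-reverseComplementᴸ : {D : Labelling v d} →
  IsDiamondLabelling D → IsDiamondLabelling (reverseComplementᴸ D)
IsDiamondLabelling-reverseComplementᴸ {D = D} isD = record
  { labels-once = λ eq → reverseComplement-injective labels-once
      (trans (sym (πD-reverseComplementᴸ D _)) (trans eq (πD-reverseComplementᴸ D _)))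
  ; least<middle = λ i j k j-least 0<k k<top →
      let (0<k′ , k′<top) = toℕ-opposite-middle k 0<k k<top
      in opposite-reverses-< (middle<greatest (opposite i) (opposite k) (opposite j)
           0<k′ k′<top (toℕ-opposite-least j j-least))
  ; middle<greatest = λ i j k 0<j j<top k-greatest →
      let (0<j′ , j′<top) = toℕ-opposite-middle j 0<j j<top
      in opposite-reverses-< (least<middle (opposite i) (opposite k) (opposite j)
           (toℕ-opposite-greatest k k-greatest) 0<j′ j′<top)
  }
  where open IsDiamondLabelling isD

Avoids-πD-reverseComplementᴸ : {p q : Fin m → Fin m} → reverseComplement p ≗ q →
  (D : Labelling v d) → Avoids p (πD D) → Avoids q (πD (reverseComplementᴸ D))
Avoids-πD-reverseComplementᴸ {p = p} rp≗q D p-avoided =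
  Avoids-reverseComplement {π = πD D} p-avoided
  ∘ Contains-resp-≗ {p′ = reverseComplement p} (sym ∘ rp≗q) (πD-reverseComplementᴸ D)

reverseComplementᴸ-𝒟 : {p q : Fin m → Fin m} → reverseComplement p ≗ q → 𝒟 v d p → 𝒟 v d q
reverseComplementᴸ-𝒟 rp≗q (D , isD , p-avoided) =
  reverseComplementᴸ D , IsDiamondLabelling-reverseComplementᴸ isD ,
  Avoids-πD-reverseComplementᴸ rp≗q D p-avoided

corollary2p9 : (v d : ℕ) → 4 ≤ v → 1 ≤ d → SameSize𝒟 v d p231 p312
corollary2p9 v d _ _ =
    reverseComplementᴸ-𝒟 reverseComplement-p231
  , reverseComplementᴸ-𝒟 reverseComplement-p312
  , (λ (D , _) → reverseComplementᴸ-involutive D)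
  , (λ (D , _) → reverseComplementᴸ-involutive D)
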